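{- For all $n,r\in\{0,1,2,\dots\}$, \[ S(n+r,r) =\frac{(n+r)!}{r!}\sum_{k=0}^{n} \frac{(-r)_{k}}{(n+k)!}\sum_{\ell=0}^k(-1)^{\ell}\binom{n+k}{k-\ell}S(n+\ell,\ell). \]
   Context: $S(n,k)$ denotes the Stirling numbers of the second kind ($S(0,0)=1$, $S(n,0)=0$ for $n\ge1$). $(\lambda)_k=\lambda(\lambda+1)\cdots(\lambda+k-1)$ for $k\ge1$, $(\lambda)_0=1$. -}

module Defs where

open import Data.Nat using (ℕ; zero; suc; _+_; _*_; _∸_)
open import Data.Nat.Combinatorics using (_C_)
open import Data.Nat.Properties using (_!≢0)
open import Data.Nat.Base using (_!)
open import Data.Integer as ℤ using (ℤ; +_; -_; -1ℤ)
open import Data.Rational as ℚ using (ℚ)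

Stirling2 : ℕ → ℕ → ℕ
Stirling2 zero    zero    = 1
Stirling2 zero    (suc k) = 0
Stirling2 (suc n) zero    = 0
Stirling2 (suc n) (suc k) = suc k * Stirling2 n (suc k) + Stirling2 n k

rising : ℤ → ℕ → ℤ
rising x zero    = ℤ.+ 1
rising x (suc k) = rising x k ℤ.* (x ℤ.+ ℤ.+ k)

-- Σ_{i=0}^{n} f i  (inclusive upper bound)
sumℤ : ℕ → (ℕ → ℤ) → ℤ
sumℤ zero    f = f zero
sumℤ (suc n) f = sumℤ n f ℤ.+ f (suc n)

sumℚ : ℕ → (ℕ → ℚ) → ℚ
sumℚ zero    f = f zero
sumℚ (suc n) f = sumℚ n f ℚ.+ f (suc n)

signℤ : ℕ → ℤ
signℤ zero    = ℤ.+ 1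
signℤ (suc l) = -1ℤ ℤ.* signℤ l

_/fact_ : ℤ → ℕ → ℚ
a /fact m = ℚ._/_ a (m !) {{m !≢0}}

module Submission where

-- For fixed n, m ↦ S(m, m − n) is a polynomial in m of degree 2n that vanishes at m = 0, …, n − 1
-- (induction on n through the Stirling recurrence).  Newton's forward expansion of it at m = n + r
-- therefore keeps only the differences of orders n + k, 0 ≤ k ≤ n, and the (n + k)-th difference at 0
-- is (−1)^n times the inner sum of the theorem.  The coefficients match because
-- (n + r)!/r! · (−r)_k/(n + k)! = (−1)^k C(n + r, n + k).

open import Defs
open import Data.Nat as ℕ using (ℕ; zero; suc; _∸_; _!; z≤n; s≤s)
import Data.Nat.Properties as ℕP
open import Data.Nat.Properties using (_!≢0; _!*_!≢0)
open import Data.Nat.Combinatorics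
  using (_C_; nCk+nC[k+1]≡[n+1]C[k+1]; k>n⇒nCk≡0; nCk≡nC[n∸k]; nCk≡n!/k![n-k]!; k![n∸k]!∣n!)
open import Data.Nat.DivMod using (m/n*n≡m)
open import Data.Integer as ℤ using (ℤ; +_; -_; _+_; _*_; _-_; 0ℤ; 1ℤ; -1ℤ)
import Data.Integer.Properties as ℤP
open import Data.Integer.Tactic.RingSolver using (solve-∀)
open import Data.Rational as ℚ using (ℚ)
import Data.Rational.Properties as ℚP
import Data.Rational.Unnormalised as ℚᵘ
import Data.Rational.Unnormalised.Properties as ℚᵘP
open import Data.Product using (_,_)
open import Data.Sum using (inj₁; inj₂)
open import Relation.Nullary using (yes; no)
open import Relation.Binary.PropositionalEquality
open ≡-Reasoning

sumℤ-cong : ∀ n {f g : ℕ → ℤ} → (∀ i → i ℕ.≤ n → f i ≡ g i) → sumℤ n f ≡ sumℤ n g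
sumℤ-cong zero    eq = eq 0 z≤n
sumℤ-cong (suc n) eq =
  cong₂ _+_ (sumℤ-cong n (λ i i≤n → eq i (ℕP.m≤n⇒m≤1+n i≤n))) (eq (suc n) ℕP.≤-refl)

sumℤ-+ : ∀ n (f g : ℕ → ℤ) → sumℤ n (λ i → f i + g i) ≡ sumℤ n f + sumℤ n g
sumℤ-+ zero    f g = refl
sumℤ-+ (suc n) f g =
  trans (cong (_+ (f (suc n) + g (suc n))) (sumℤ-+ n f g)) (interchange (sumℤ n f) (sumℤ n g) (f (suc n)) (g (suc n)))
  where
  interchange : ∀ (a b c d : ℤ) → (a + b) + (c + d) ≡ (a + c) + (b + d)
  interchange = solve-∀

sumℤ-*ˡ : ∀ n (c : ℤ) (f : ℕ → ℤ) → sumℤ n (λ i → c * f i) ≡ c * sumℤ n f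
sumℤ-*ˡ zero    c f = refl
sumℤ-*ˡ (suc n) c f =
  trans (cong (_+ (c * f (suc n))) (sumℤ-*ˡ n c f)) (sym (ℤP.*-distribˡ-+ c (sumℤ n f) (f (suc n))))

sumℤ-neg : ∀ n (f : ℕ → ℤ) → sumℤ n (λ i → - f i) ≡ - sumℤ n f
sumℤ-neg zero    f = refl
sumℤ-neg (suc n) f =
  trans (cong (_+ (- f (suc n))) (sumℤ-neg n f)) (sym (ℤP.neg-distrib-+ (sumℤ n f) (f (suc n))))

sumℤ-suc : ∀ n (f : ℕ → ℤ) → sumℤ (suc n) f ≡ f 0 + sumℤ n (λ i → f (suc i))
sumℤ-suc zero    f = refl
sumℤ-suc (suc n) f =
  trans (cong (_+ f (suc (suc n))) (sumℤ-suc n f)) (ℤP.+-assoc (f 0) _ (f (suc (suc n))))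

sumℤ-zero : ∀ n (f : ℕ → ℤ) → (∀ i → f i ≡ 0ℤ) → sumℤ n f ≡ 0ℤ
sumℤ-zero zero    f f≡0 = f≡0 0
sumℤ-zero (suc n) f f≡0 = cong₂ _+_ (sumℤ-zero n f f≡0) (f≡0 (suc n))

sumℤ-vanishing-tail : ∀ a b (f : ℕ → ℤ) → (∀ i → a ℕ.< i → f i ≡ 0ℤ) → sumℤ (a ℕ.+ b) f ≡ sumℤ a f
sumℤ-vanishing-tail a zero    f f≡0 = cong (λ x → sumℤ x f) (ℕP.+-identityʳ a)
sumℤ-vanishing-tail a (suc b) f f≡0 rewrite ℕP.+-suc a b | f≡0 (suc (a ℕ.+ b)) (s≤s (ℕP.m≤m+n a b)) =
  trans (ℤP.+-identityʳ _) (sumℤ-vanishing-tail a b f f≡0)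

sumℤ-vanishing-head : ∀ n k (f : ℕ → ℤ) → (∀ i → i ℕ.< n → f i ≡ 0ℤ) →
                      sumℤ (n ℕ.+ k) f ≡ sumℤ k (λ l → f (n ℕ.+ l))
sumℤ-vanishing-head zero    k f f≡0 = refl
sumℤ-vanishing-head (suc n) k f f≡0 = begin
  sumℤ (suc (n ℕ.+ k)) f                      ≡⟨ sumℤ-suc (n ℕ.+ k) f ⟩
  f 0 + sumℤ (n ℕ.+ k) (λ i → f (suc i))      ≡⟨ cong₂ _+_ (f≡0 0 (s≤s z≤n)) tail ⟩
  0ℤ + sumℤ k (λ l → f (suc n ℕ.+ l))         ≡⟨ ℤP.+-identityˡ _ ⟩
  sumℤ k (λ l → f (suc n ℕ.+ l))              ∎
  where
  tail = sumℤ-vanishing-head n k (λ i → f (suc i)) (λ i i<n → f≡0 (suc i) (s≤s i<n))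

*-*-zeroʳ : ∀ a b {c} → c ≡ 0ℤ → a * (b * c) ≡ 0ℤ
*-*-zeroʳ a b refl = trans (cong (a *_) (ℤP.*-zeroʳ b)) (ℤP.*-zeroʳ a)

signℤ-+ : ∀ m n → signℤ (m ℕ.+ n) ≡ signℤ m * signℤ n
signℤ-+ zero    n = sym (ℤP.*-identityˡ (signℤ n))
signℤ-+ (suc m) n = trans (cong (-1ℤ *_) (signℤ-+ m n)) (sym (ℤP.*-assoc -1ℤ (signℤ m) (signℤ n)))

signℤ-+-cancelˡ : ∀ m n x → signℤ (m ℕ.+ n) * (signℤ m * x) ≡ signℤ n * x
signℤ-+-cancelˡ zero    n x = cong (signℤ n *_) (ℤP.*-identityˡ x)
signℤ-+-cancelˡ (suc m) n x =
  trans (double-negation (signℤ (m ℕ.+ n)) (signℤ m) x) (signℤ-+-cancelˡ m n x)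
  where
  double-negation : ∀ (s t x : ℤ) → (-1ℤ * s) * ((-1ℤ * t) * x) ≡ s * (t * x)
  double-negation = solve-∀

sumℤ-pascal : ∀ j (t : ℕ → ℤ) →
  sumℤ (suc j) (λ i → + (suc j C i) * t i)
    ≡ sumℤ j (λ i → + (j C i) * t i) + sumℤ j (λ i → + (j C i) * t (suc i))
sumℤ-pascal j t = begin
  sumℤ (suc j) (λ i → + (suc j C i) * t i)                           ≡⟨ sumℤ-suc j _ ⟩
  t₀ + sumℤ j (λ i → + (suc j C suc i) * t (suc i))                  ≡⟨ cong (λ s → t₀ + s) split ⟩
  t₀ + (X + Y)                                                       ≡⟨ rotate t₀ X Y ⟩
  (t₀ + Y) + X                                                       ≡⟨ cong (_+ X) lower ⟨
  W + X                                                              ∎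
  where
  t₀ = + 1 * t 0
  W = sumℤ j (λ i → + (j C i) * t i)
  X = sumℤ j (λ i → + (j C i) * t (suc i))
  Y = sumℤ j (λ i → + (j C suc i) * t (suc i))
  pascal : ∀ i → + (suc j C suc i) * t (suc i) ≡ + (j C i) * t (suc i) + + (j C suc i) * t (suc i)
  pascal i = begin
    + (suc j C suc i) * t (suc i)                   ≡⟨ cong (λ c → + c * t (suc i)) (nCk+nC[k+1]≡[n+1]C[k+1] j i) ⟨
    + (j C i ℕ.+ j C suc i) * t (suc i)             ≡⟨ cong (_* t (suc i)) (ℤP.pos-+ (j C i) (j C suc i)) ⟩
    (+ (j C i) + + (j C suc i)) * t (suc i)         ≡⟨ ℤP.*-distribʳ-+ (t (suc i)) (+ (j C i)) (+ (j C suc i)) ⟩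
    + (j C i) * t (suc i) + + (j C suc i) * t (suc i) ∎
  split : sumℤ j (λ i → + (suc j C suc i) * t (suc i)) ≡ X + Y
  split = trans (sumℤ-cong j (λ i _ → pascal i)) (sumℤ-+ j _ _)
  -- the extra term of index j + 1 carries the factor j C (j + 1) = 0
  lower : W ≡ t₀ + Y
  lower = begin
    W                                         ≡⟨ ℤP.+-identityʳ W ⟨
    W + 0ℤ                                    ≡⟨ cong (λ c → W + + c * t (suc j)) (k>n⇒nCk≡0 (ℕP.n<1+n j)) ⟨
    sumℤ (suc j) (λ i → + (j C i) * t i)      ≡⟨ sumℤ-suc j _ ⟩
    t₀ + Y                                    ∎
  rotate : ∀ (a b c : ℤ) → a + (b + c) ≡ (a + c) + b
  rotate = solve-∀

sumℤ-alternating-pascal : ∀ j (x : ℕ → ℤ) →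
  sumℤ j (λ i → + (j C i) * (signℤ i * x i)) - sumℤ j (λ i → + (j C i) * (signℤ i * x (suc i)))
    ≡ sumℤ (suc j) (λ i → + (suc j C i) * (signℤ i * x i))
sumℤ-alternating-pascal j x = begin
  S - sumℤ j (λ i → + (j C i) * (signℤ i * x (suc i)))          ≡⟨ cong (λ s → S + s) (sumℤ-neg j _) ⟨
  S + sumℤ j (λ i → - (+ (j C i) * (signℤ i * x (suc i))))      ≡⟨ cong (λ s → S + s) (sumℤ-cong j λ i _ → flip (+ (j C i)) (signℤ i) (x (suc i))) ⟩
  S + sumℤ j (λ i → + (j C i) * (signℤ (suc i) * x (suc i)))    ≡⟨ sumℤ-pascal j (λ i → signℤ i * x i) ⟨
  sumℤ (suc j) (λ i → + (suc j C i) * (signℤ i * x i))          ∎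
  where
  S = sumℤ j (λ i → + (j C i) * (signℤ i * x i))
  flip : ∀ (c s y : ℤ) → - (c * (s * y)) ≡ c * ((-1ℤ * s) * y)
  flip = solve-∀

-- Sign chosen so that Δ^ j f 0 = Σᵢ (−1)^i C(j, i) f i, the alternating sums of the theorem.
Δ : (ℕ → ℤ) → ℕ → ℤ
Δ f m = f m - f (suc m)

Δ^ : ℕ → (ℕ → ℤ) → ℕ → ℤ
Δ^ zero    f = f
Δ^ (suc j) f = Δ^ j (Δ f)

Δ^-suc : ∀ j f m → Δ^ (suc j) f m ≡ Δ (Δ^ j f) m
Δ^-suc zero    f m = refl
Δ^-suc (suc j) f m = Δ^-suc j (Δ f) m

Δ^-cong : ∀ j {f g : ℕ → ℤ} → (∀ m → f m ≡ g m) → ∀ m → Δ^ j f m ≡ Δ^ j g m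
Δ^-cong zero    f≗g m = f≗g m
Δ^-cong (suc j) f≗g m = Δ^-cong j (λ x → cong₂ _-_ (f≗g x) (f≗g (suc x))) m

Δ^-lin : ∀ j (a b : ℤ) f g m → Δ^ j (λ x → a * f x + b * g x) m ≡ a * Δ^ j f m + b * Δ^ j g m
Δ^-lin zero    a b f g m = refl
Δ^-lin (suc j) a b f g m =
  trans (Δ^-cong j (λ x → Δ-lin a b (f x) (g x) (f (suc x)) (g (suc x))) m) (Δ^-lin j a b (Δ f) (Δ g) m)
  where
  Δ-lin : ∀ (a b x y u v : ℤ) → (a * x + b * y) - (a * u + b * v) ≡ a * (x - u) + b * (y - v)
  Δ-lin = solve-∀

Δ^-explicit : ∀ j f m → Δ^ j f m ≡ sumℤ j (λ i → + (j C i) * (signℤ i * f (m ℕ.+ i)))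
Δ^-explicit zero    f m = sym (trans (ℤP.*-identityˡ _) (trans (ℤP.*-identityˡ _) (cong f (ℕP.+-identityʳ m))))
Δ^-explicit (suc j) f m = begin
  Δ^ (suc j) f m                                                    ≡⟨ Δ^-suc j f m ⟩
  Δ^ j f m - Δ^ j f (suc m)                                         ≡⟨ cong₂ _-_ (Δ^-explicit j f m) (Δ^-explicit j f (suc m)) ⟩
  S m - sumℤ j (λ i → + (j C i) * (signℤ i * f (suc m ℕ.+ i)))      ≡⟨ cong (λ s → S m - s) (sumℤ-cong j shift) ⟩
  S m - sumℤ j (λ i → + (j C i) * (signℤ i * f (m ℕ.+ suc i)))      ≡⟨ sumℤ-alternating-pascal j (λ i → f (m ℕ.+ i)) ⟩
  sumℤ (suc j) (λ i → + (suc j C i) * (signℤ i * f (m ℕ.+ i)))      ∎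
  where
  S : ℕ → ℤ
  S m′ = sumℤ j (λ i → + (j C i) * (signℤ i * f (m′ ℕ.+ i)))
  shift : ∀ i → i ℕ.≤ j → + (j C i) * (signℤ i * f (suc m ℕ.+ i)) ≡ + (j C i) * (signℤ i * f (m ℕ.+ suc i))
  shift i _ = cong (λ k → + (j C i) * (signℤ i * f k)) (sym (ℕP.+-suc m i))

newton : ∀ m f → f m ≡ sumℤ m (λ j → + (m C j) * (signℤ j * Δ^ j f 0))
newton zero    f = sym (trans (ℤP.*-identityˡ _) (ℤP.*-identityˡ _))
newton (suc m) f = begin
  f (suc m)                                                         ≡⟨ telescope (f m) (f (suc m)) ⟩
  f m - Δ f m                                                       ≡⟨ cong₂ _-_ (newton m f) (newton m (Δ f)) ⟩
  sumℤ m (λ j → + (m C j) * (signℤ j * Δ^ j f 0))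
    - sumℤ m (λ j → + (m C j) * (signℤ j * Δ^ (suc j) f 0))         ≡⟨ sumℤ-alternating-pascal m (λ j → Δ^ j f 0) ⟩
  sumℤ (suc m) (λ j → + (suc m C j) * (signℤ j * Δ^ j f 0))         ∎
  where
  telescope : ∀ (a b : ℤ) → b ≡ a - (a - b)
  telescope = solve-∀

Degree< : ℕ → (ℕ → ℤ) → Set
Degree< d f = ∀ m → Δ^ d f m ≡ 0ℤ

Degree<-cong : ∀ d {f g} → (∀ m → f m ≡ g m) → Degree< d f → Degree< d g
Degree<-cong d f≗g f<d m = trans (sym (Δ^-cong d f≗g m)) (f<d m)

Degree<-lin : ∀ d (a b : ℤ) {f g} → Degree< d f → Degree< d g → Degree< d (λ x → a * f x + b * g x)
Degree<-lin d a b {f} {g} f<d g<d m = begin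
  Δ^ d (λ x → a * f x + b * g x) m  ≡⟨ Δ^-lin d a b f g m ⟩
  a * Δ^ d f m + b * Δ^ d g m        ≡⟨ cong₂ (λ u v → a * u + b * v) (f<d m) (g<d m) ⟩
  a * 0ℤ + b * 0ℤ                    ≡⟨ cong₂ _+_ (ℤP.*-zeroʳ a) (ℤP.*-zeroʳ b) ⟩
  0ℤ                                 ∎

Degree<-suc : ∀ d {f} → Degree< d f → Degree< (suc d) f
Degree<-suc d {f} f<d m = begin
  Δ^ (suc d) f m             ≡⟨ Δ^-suc d f m ⟩
  Δ^ d f m - Δ^ d f (suc m)  ≡⟨ cong₂ _-_ (f<d m) (f<d (suc m)) ⟩
  0ℤ                         ∎

Degree<-+ : ∀ i d {f} → Degree< d f → Degree< (i ℕ.+ d) f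
Degree<-+ zero    d f<d = f<d
Degree<-+ (suc i) d f<d = Degree<-suc (i ℕ.+ d) (Degree<-+ i d f<d)

-- The product rule  Δ((c − m) v) = (c − m) Δv + (v − Δv)  lowers the problem to Δv.
Degree<-affine-* : ∀ d (c : ℤ) {v} → Degree< d v → Degree< (suc d) (λ m → (c - + m) * v m)
Degree<-affine-* zero    c {v} v<0 m rewrite v<0 m | v<0 (suc m) = vanish (c - + m) (c - + suc m)
  where
  vanish : ∀ (a b : ℤ) → a * 0ℤ - b * 0ℤ ≡ 0ℤ
  vanish = solve-∀
Degree<-affine-* (suc d) c {v} v<d+1 =
  Degree<-cong (suc d) (λ m → sym (product-rule c (+ m) (v m) (v (suc m))))
    (Degree<-lin (suc d) 1ℤ 1ℤ {λ m → (c - + m) * Δ v m} {λ m → 1ℤ * v m + -1ℤ * Δ v m}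
      (Degree<-affine-* d c v<d+1)
      (Degree<-lin (suc d) 1ℤ -1ℤ {v} {Δ v} v<d+1 (Degree<-suc d v<d+1)))
  where
  product-rule : ∀ (c x a b : ℤ) →
    (c - x) * a - (c - (1ℤ + x)) * b ≡ 1ℤ * ((c - x) * (a - b)) + 1ℤ * (1ℤ * a + -1ℤ * (a - b))
  product-rule = solve-∀

m<k⇒Stirling2≡0 : ∀ {m k} → m ℕ.< k → Stirling2 m k ≡ 0
m<k⇒Stirling2≡0 {zero}  {suc k} _ = refl
m<k⇒Stirling2≡0 {suc m} {suc k} (s≤s m<k)
  rewrite m<k⇒Stirling2≡0 (ℕP.m<n⇒m<1+n m<k) | m<k⇒Stirling2≡0 m<k =
  trans (ℕP.+-identityʳ _) (ℕP.*-zeroʳ (suc k))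

Stirling2[n,n]≡1 : ∀ n → Stirling2 n n ≡ 1
Stirling2[n,n]≡1 zero = refl
Stirling2[n,n]≡1 (suc n) rewrite m<k⇒Stirling2≡0 (ℕP.n<1+n n) | Stirling2[n,n]≡1 n =
  cong (ℕ._+ 1) (ℕP.*-zeroʳ (suc n))

-- stirlingDiag n m = S(m, m − n) for m ≥ n and 0 for m < n: the Stirling recurrence read along a
-- diagonal.  The truncated m ∸ n only occurs where stirlingDiag n m = 0.
stirlingDiag : ℕ → ℕ → ℕ
stirlingDiag zero    m       = 1
stirlingDiag (suc n) zero    = 0
stirlingDiag (suc n) (suc m) = (m ∸ n) ℕ.* stirlingDiag n m ℕ.+ stirlingDiag (suc n) m

stirlingDiagℤ : ℕ → ℕ → ℤ
stirlingDiagℤ n m = + stirlingDiag n m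

stirlingDiag-vanishes : ∀ {n m} → m ℕ.< n → stirlingDiag n m ≡ 0
stirlingDiag-vanishes {suc n} {zero}  _ = refl
stirlingDiag-vanishes {suc n} {suc m} (s≤s m<n)
  rewrite stirlingDiag-vanishes m<n | stirlingDiag-vanishes {suc n} (ℕP.m<n⇒m<1+n m<n) =
  trans (ℕP.+-identityʳ _) (ℕP.*-zeroʳ (m ∸ n))

stirlingDiag-Stirling2 : ∀ n l → stirlingDiag n (n ℕ.+ l) ≡ Stirling2 (n ℕ.+ l) l
stirlingDiag-Stirling2 zero    l = sym (Stirling2[n,n]≡1 l)
stirlingDiag-Stirling2 (suc n) zero
  rewrite ℕP.+-identityʳ n | ℕP.n∸n≡0 n | stirlingDiag-vanishes {suc n} (ℕP.n<1+n n) = refl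
stirlingDiag-Stirling2 (suc n) (suc l) =
  cong₂ ℕ._+_ (cong₂ ℕ._*_ (ℕP.m+n∸m≡n n (suc l)) (stirlingDiag-Stirling2 n (suc l)))
              (subst (λ m → stirlingDiag (suc n) m ≡ Stirling2 m l) (sym (ℕP.+-suc n l))
                     (stirlingDiag-Stirling2 (suc n) l))

+[m∸n]*stirlingDiag : ∀ n m → + (m ∸ n) * stirlingDiagℤ n m ≡ (+ m - + n) * stirlingDiagℤ n m
+[m∸n]*stirlingDiag n m with n ℕP.≤? m
... | yes n≤m = cong (_* stirlingDiagℤ n m) (sym (trans (ℤP.m-n≡m⊖n m n) (ℤP.⊖-≥ n≤m)))
... | no  n≰m rewrite stirlingDiag-vanishes (ℕP.≰⇒> n≰m) =
  trans (ℤP.*-zeroʳ (+ (m ∸ n))) (sym (ℤP.*-zeroʳ (+ m - + n)))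

Δ-stirlingDiag : ∀ n m → Δ (stirlingDiagℤ (suc n)) m ≡ (+ n - + m) * stirlingDiagℤ n m
Δ-stirlingDiag n m = begin
  + a - + ((m ∸ n) ℕ.* b ℕ.+ a)      ≡⟨ cong (λ x → + a - x) (ℤP.pos-+ ((m ∸ n) ℕ.* b) a) ⟩
  + a - (+ ((m ∸ n) ℕ.* b) + + a)    ≡⟨ cong (λ x → + a - (x + + a)) (ℤP.pos-* (m ∸ n) b) ⟩
  + a - (+ (m ∸ n) * + b + + a)      ≡⟨ cong (λ x → + a - (x + + a)) (+[m∸n]*stirlingDiag n m) ⟩
  + a - ((+ m - + n) * + b + + a)    ≡⟨ cancel (+ a) (+ b) (+ m) (+ n) ⟩
  (+ n - + m) * + b                  ∎
  where
  a = stirlingDiag (suc n) m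
  b = stirlingDiag n m
  cancel : ∀ (a b m n : ℤ) → a - ((m - n) * b + a) ≡ (n - m) * b
  cancel = solve-∀

stirlingDiag-degree : ∀ n → Degree< (suc (n ℕ.+ n)) (stirlingDiagℤ n)
stirlingDiag-degree zero    m = refl
stirlingDiag-degree (suc n) =
  subst (λ d → Degree< (suc (suc d)) (stirlingDiagℤ (suc n))) (sym (ℕP.+-suc n n))
    (Degree<-cong (suc (suc (n ℕ.+ n))) (λ m → sym (Δ-stirlingDiag n m))
      (Degree<-affine-* (suc (n ℕ.+ n)) (+ n) (stirlingDiag-degree n)))

innerSum : ℕ → ℕ → ℤ
innerSum n k = sumℤ k (λ l → signℤ l * (+ ((n ℕ.+ k) C (k ∸ l)) * + Stirling2 (n ℕ.+ l) l))

Δ^-stirlingDiag-below : ∀ {n j} → j ℕ.< n → Δ^ j (stirlingDiagℤ n) 0 ≡ 0ℤ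
Δ^-stirlingDiag-below {n} {j} j<n = trans (Δ^-explicit j (stirlingDiagℤ n) 0) (sumℤ-zero j _ term≡0)
  where
  term≡0 : ∀ i → + (j C i) * (signℤ i * stirlingDiagℤ n i) ≡ 0ℤ
  term≡0 i with i ℕP.<? n
  ... | yes i<n = *-*-zeroʳ (+ (j C i)) (signℤ i) (cong +_ (stirlingDiag-vanishes i<n))
  ... | no  i≮n rewrite k>n⇒nCk≡0 {j} {i} (ℕP.<-≤-trans j<n (ℕP.≮⇒≥ i≮n)) = refl

Δ^-stirlingDiag-above : ∀ {n j} → n ℕ.+ n ℕ.< j → Δ^ j (stirlingDiagℤ n) 0 ≡ 0ℤ
Δ^-stirlingDiag-above {n} {j} 2n<j with ℕP.m≤n⇒∃[o]m+o≡n 2n<j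
... | o , refl = subst (λ d → Degree< d (stirlingDiagℤ n)) (ℕP.+-comm o (suc (n ℕ.+ n)))
                   (Degree<-+ o (suc (n ℕ.+ n)) (stirlingDiag-degree n)) 0

Δ^-stirlingDiag-middle : ∀ n k → Δ^ (n ℕ.+ k) (stirlingDiagℤ n) 0 ≡ signℤ n * innerSum n k
Δ^-stirlingDiag-middle n k = begin
  Δ^ (n ℕ.+ k) (stirlingDiagℤ n) 0
    ≡⟨ Δ^-explicit (n ℕ.+ k) (stirlingDiagℤ n) 0 ⟩
  sumℤ (n ℕ.+ k) (λ i → + ((n ℕ.+ k) C i) * (signℤ i * stirlingDiagℤ n i))
    ≡⟨ sumℤ-vanishing-head n k _ below ⟩
  sumℤ k (λ l → + ((n ℕ.+ k) C (n ℕ.+ l)) * (signℤ (n ℕ.+ l) * stirlingDiagℤ n (n ℕ.+ l)))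
    ≡⟨ sumℤ-cong k term ⟩
  sumℤ k (λ l → signℤ n * (signℤ l * (+ ((n ℕ.+ k) C (k ∸ l)) * + Stirling2 (n ℕ.+ l) l)))
    ≡⟨ sumℤ-*ˡ k (signℤ n) _ ⟩
  signℤ n * innerSum n k ∎
  where
  below : ∀ i → i ℕ.< n → + ((n ℕ.+ k) C i) * (signℤ i * stirlingDiagℤ n i) ≡ 0ℤ
  below i i<n = *-*-zeroʳ (+ ((n ℕ.+ k) C i)) (signℤ i) (cong +_ (stirlingDiag-vanishes i<n))
  term : ∀ l → l ℕ.≤ k → + ((n ℕ.+ k) C (n ℕ.+ l)) * (signℤ (n ℕ.+ l) * stirlingDiagℤ n (n ℕ.+ l))
                      ≡ signℤ n * (signℤ l * (+ ((n ℕ.+ k) C (k ∸ l)) * + Stirling2 (n ℕ.+ l) l))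
  term l l≤k rewrite signℤ-+ n l | stirlingDiag-Stirling2 n l
                   | nCk≡nC[n∸k] (ℕP.+-monoʳ-≤ n l≤k) | ℕP.[m+n]∸[m+o]≡n∸o n k l =
    regroup (+ ((n ℕ.+ k) C (k ∸ l))) (signℤ n) (signℤ l) (+ Stirling2 (n ℕ.+ l) l)
    where
    regroup : ∀ (c s t x : ℤ) → c * ((s * t) * x) ≡ s * (t * (c * x))
    regroup = solve-∀

-- Newton's expansion of the diagonal at m = n + r: only the differences of orders n, …, 2n survive.
Stirling2-binomial-expansion : ∀ n r →
  + Stirling2 (n ℕ.+ r) r ≡ sumℤ n (λ k → signℤ k * + ((n ℕ.+ r) C (n ℕ.+ k)) * innerSum n k)
Stirling2-binomial-expansion n r = begin
  + Stirling2 (n ℕ.+ r) r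
    ≡⟨ cong +_ (stirlingDiag-Stirling2 n r) ⟨
  stirlingDiagℤ n (n ℕ.+ r)
    ≡⟨ newton (n ℕ.+ r) (stirlingDiagℤ n) ⟩
  sumℤ (n ℕ.+ r) (λ j → + ((n ℕ.+ r) C j) * (signℤ j * Δ^ j (stirlingDiagℤ n) 0))
    ≡⟨ sumℤ-vanishing-head n r _ (λ j j<n → *-*-zeroʳ (+ ((n ℕ.+ r) C j)) (signℤ j) (Δ^-stirlingDiag-below j<n)) ⟩
  sumℤ r T
    ≡⟨ sumℤ-vanishing-tail r n T (λ k r<k → cong (λ c → + c * _) (k>n⇒nCk≡0 (ℕP.+-monoʳ-< n r<k))) ⟨
  sumℤ (r ℕ.+ n) T
    ≡⟨ cong (λ m → sumℤ m T) (ℕP.+-comm r n) ⟩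
  sumℤ (n ℕ.+ r) T
    ≡⟨ sumℤ-vanishing-tail n r T (λ k n<k → *-*-zeroʳ (+ ((n ℕ.+ r) C (n ℕ.+ k))) (signℤ (n ℕ.+ k))
                                                (Δ^-stirlingDiag-above {n} (ℕP.+-monoʳ-< n n<k))) ⟩
  sumℤ n T
    ≡⟨ sumℤ-cong n (λ k _ → middle k) ⟩
  sumℤ n (λ k → signℤ k * + ((n ℕ.+ r) C (n ℕ.+ k)) * innerSum n k) ∎
  where
  T : ℕ → ℤ
  T k = + ((n ℕ.+ r) C (n ℕ.+ k)) * (signℤ (n ℕ.+ k) * Δ^ (n ℕ.+ k) (stirlingDiagℤ n) 0)
  middle : ∀ k → T k ≡ signℤ k * + ((n ℕ.+ r) C (n ℕ.+ k)) * innerSum n k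
  middle k = begin
    c * (signℤ (n ℕ.+ k) * Δ^ (n ℕ.+ k) (stirlingDiagℤ n) 0)
      ≡⟨ cong (λ x → c * (signℤ (n ℕ.+ k) * x)) (Δ^-stirlingDiag-middle n k) ⟩
    c * (signℤ (n ℕ.+ k) * (signℤ n * innerSum n k))
      ≡⟨ cong (c *_) (signℤ-+-cancelˡ n k (innerSum n k)) ⟩
    c * (signℤ k * innerSum n k)
      ≡⟨ swap c (signℤ k) (innerSum n k) ⟩
    signℤ k * c * innerSum n k ∎
    where
    c = + ((n ℕ.+ r) C (n ℕ.+ k))
    swap : ∀ (c s x : ℤ) → c * (s * x) ≡ s * c * x
    swap = solve-∀

rising-neg : ∀ k d → rising (- + (k ℕ.+ d)) k * + (d !) ≡ signℤ k * + ((k ℕ.+ d) !)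
rising-neg zero    d = refl
rising-neg (suc k) d = begin
  rising x k * (x + + k) * + (d !)           ≡⟨ cong (λ y → rising x k * y * + (d !)) last-factor ⟩
  rising x k * - + suc d * + (d !)           ≡⟨ pull-sign (rising x k) (+ suc d) (+ (d !)) ⟩
  -1ℤ * (rising x k * (+ suc d * + (d !)))   ≡⟨ cong (λ y → -1ℤ * (rising x k * y)) (ℤP.pos-* (suc d) (d !)) ⟨
  -1ℤ * (rising x k * + (suc d !))           ≡⟨ cong (-1ℤ *_) shifted ⟩
  -1ℤ * (signℤ k * + ((suc k ℕ.+ d) !))      ≡⟨ ℤP.*-assoc -1ℤ (signℤ k) _ ⟨
  signℤ (suc k) * + ((suc k ℕ.+ d) !)        ∎
  where
  x = - + (suc k ℕ.+ d)
  last-factor : x + + k ≡ - + suc d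
  last-factor = begin
    - + (suc k ℕ.+ d) + + k     ≡⟨ cong (λ y → - y + + k) (trans (cong +_ (sym (ℕP.+-suc k d))) (ℤP.pos-+ k (suc d))) ⟩
    - (+ k + + suc d) + + k     ≡⟨ cancel (+ k) (+ suc d) ⟩
    - + suc d                   ∎
    where
    cancel : ∀ (a b : ℤ) → - (a + b) + a ≡ - b
    cancel = solve-∀
  pull-sign : ∀ (p a b : ℤ) → (p * (- a)) * b ≡ -1ℤ * (p * (a * b))
  pull-sign = solve-∀
  shifted : rising x k * + (suc d !) ≡ signℤ k * + ((suc k ℕ.+ d) !)
  shifted = subst (λ m → rising (- + m) k * + (suc d !) ≡ signℤ k * + (m !)) (ℕP.+-suc k d) (rising-neg k (suc d))

rising-neg-vanishes : ∀ {r k} → r ℕ.< k → rising (- + r) k ≡ 0ℤ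
rising-neg-vanishes {r} {suc k} (s≤s r≤k) with ℕP.m≤n⇒m<n∨m≡n r≤k
... | inj₁ r<k  rewrite rising-neg-vanishes r<k = refl
... | inj₂ refl rewrite ℤP.+-inverseˡ (+ r) = ℤP.*-zeroʳ (rising (- + r) r)

nCk*k!*[n∸k]!≡n! : ∀ {n k} → k ℕ.≤ n → (n C k) ℕ.* (k ! ℕ.* (n ∸ k) !) ≡ n !
nCk*k!*[n∸k]!≡n! {n} {k} k≤n =
  trans (cong (ℕ._* (k ! ℕ.* (n ∸ k) !)) (nCk≡n!/k![n-k]! k≤n))
        (m/n*n≡m {{k !* (n ∸ k) !≢0}} (k![n∸k]!∣n! k≤n))

!-*-rising-neg-+ : ∀ n k d → + ((n ℕ.+ (k ℕ.+ d)) !) * rising (- + (k ℕ.+ d)) k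
                             ≡ signℤ k * + ((n ℕ.+ (k ℕ.+ d)) C (n ℕ.+ k)) * + ((k ℕ.+ d) ! ℕ.* (n ℕ.+ k) !)
!-*-rising-neg-+ n k d = begin
  + (N !) * R                                         ≡⟨ cong (λ m → + m * R) factorial ⟨
  + (c ℕ.* ((n ℕ.+ k) ! ℕ.* d !)) * R                 ≡⟨ cong (_* R) (pos-*³ c ((n ℕ.+ k) !) (d !)) ⟩
  + c * (+ ((n ℕ.+ k) !) * + (d !)) * R               ≡⟨ reassoc (+ c) (+ ((n ℕ.+ k) !)) (+ (d !)) R ⟩
  + c * + ((n ℕ.+ k) !) * (R * + (d !))               ≡⟨ cong (+ c * + ((n ℕ.+ k) !) *_) (rising-neg k d) ⟩
  + c * + ((n ℕ.+ k) !) * (signℤ k * + ((k ℕ.+ d) !)) ≡⟨ regroup (+ c) (+ ((n ℕ.+ k) !)) (signℤ k) (+ ((k ℕ.+ d) !)) ⟩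
  signℤ k * + c * (+ ((k ℕ.+ d) !) * + ((n ℕ.+ k) !)) ≡⟨ cong (signℤ k * + c *_) (ℤP.pos-* ((k ℕ.+ d) !) ((n ℕ.+ k) !)) ⟨
  signℤ k * + c * + ((k ℕ.+ d) ! ℕ.* (n ℕ.+ k) !)     ∎
  where
  N = n ℕ.+ (k ℕ.+ d)
  c = N C (n ℕ.+ k)
  R = rising (- + (k ℕ.+ d)) k
  factorial : c ℕ.* ((n ℕ.+ k) ! ℕ.* d !) ≡ N !
  factorial = subst (λ e → c ℕ.* ((n ℕ.+ k) ! ℕ.* e !) ≡ N !)
                    (trans (ℕP.[m+n]∸[m+o]≡n∸o n (k ℕ.+ d) k) (ℕP.m+n∸m≡n k d))
                    (nCk*k!*[n∸k]!≡n! (ℕP.+-monoʳ-≤ n (ℕP.m≤m+n k d)))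
  pos-*³ : ∀ a b e → + (a ℕ.* (b ℕ.* e)) ≡ + a * (+ b * + e)
  pos-*³ a b e = trans (ℤP.pos-* a (b ℕ.* e)) (cong (+ a *_) (ℤP.pos-* b e))
  reassoc : ∀ (a b e x : ℤ) → a * (b * e) * x ≡ a * b * (x * e)
  reassoc = solve-∀
  regroup : ∀ (a b s f : ℤ) → a * b * (s * f) ≡ s * a * (f * b)
  regroup = solve-∀

!-*-rising-neg : ∀ n r k →
  + ((n ℕ.+ r) !) * rising (- + r) k ≡ signℤ k * + ((n ℕ.+ r) C (n ℕ.+ k)) * + (r ! ℕ.* (n ℕ.+ k) !)
!-*-rising-neg n r k with k ℕP.≤? r
... | yes k≤r =
  subst (λ r → + ((n ℕ.+ r) !) * rising (- + r) k ≡ signℤ k * + ((n ℕ.+ r) C (n ℕ.+ k)) * + (r ! ℕ.* (n ℕ.+ k) !))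
        (ℕP.m+[n∸m]≡n k≤r) (!-*-rising-neg-+ n k (r ∸ k))
... | no k≰r rewrite rising-neg-vanishes (ℕP.≰⇒> k≰r) | k>n⇒nCk≡0 (ℕP.+-monoʳ-< n (ℕP.≰⇒> k≰r)) =
  trans (ℤP.*-zeroʳ (+ ((n ℕ.+ r) !))) (cong (_* + (r ! ℕ.* (n ℕ.+ k) !)) (sym (ℤP.*-zeroʳ (signℤ k))))

/*/≡/1 : ∀ (a b c : ℤ) (p q : ℕ) .{{_ : ℕ.NonZero p}} .{{_ : ℕ.NonZero q}} →
         a * b ≡ c * + (p ℕ.* q) → (a ℚ./ p) ℚ.* (b ℚ./ q) ≡ c ℚ./ 1
/*/≡/1 a b c (suc p) (suc q) ab≡cpq = ℚP.toℚᵘ-injective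
  (ℚᵘP.≃-trans (ℚP.toℚᵘ-homo-* (a ℚ./ suc p) (b ℚ./ suc q))
  (ℚᵘP.≃-trans (ℚᵘP.*-cong (ℚP.toℚᵘ-fromℚᵘ (ℚᵘ.mkℚᵘ a p)) (ℚP.toℚᵘ-fromℚᵘ (ℚᵘ.mkℚᵘ b q)))
  (ℚᵘP.≃-trans (ℚᵘ.*≡* (trans (ℤP.*-identityʳ (a * b)) ab≡cpq))
               (ℚᵘP.≃-sym (ℚP.toℚᵘ-fromℚᵘ (ℚᵘ.mkℚᵘ c 0))))))

/1+/1 : ∀ (a b : ℤ) → (a ℚ./ 1) ℚ.+ (b ℚ./ 1) ≡ (a + b) ℚ./ 1
/1+/1 a b = ℚP.toℚᵘ-injective
  (ℚᵘP.≃-trans (ℚP.toℚᵘ-homo-+ (a ℚ./ 1) (b ℚ./ 1))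
  (ℚᵘP.≃-trans (ℚᵘP.+-cong (ℚP.toℚᵘ-fromℚᵘ (ℚᵘ.mkℚᵘ a 0)) (ℚP.toℚᵘ-fromℚᵘ (ℚᵘ.mkℚᵘ b 0)))
  (ℚᵘP.≃-trans (ℚᵘ.*≡* (over-one a b))
               (ℚᵘP.≃-sym (ℚP.toℚᵘ-fromℚᵘ (ℚᵘ.mkℚᵘ (a + b) 0))))))
  where
  over-one : ∀ (a b : ℤ) → (a * 1ℤ + b * 1ℤ) * 1ℤ ≡ (a + b) * 1ℤ
  over-one = solve-∀

sumℚ-/1 : ∀ n (h : ℕ → ℤ) → sumℚ n (λ k → h k ℚ./ 1) ≡ sumℤ n h ℚ./ 1
sumℚ-/1 zero    h = refl
sumℚ-/1 (suc n) h = trans (cong (ℚ._+ (h (suc n) ℚ./ 1)) (sumℚ-/1 n h)) (/1+/1 (sumℤ n h) (h (suc n)))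

sumℚ-cong : ∀ n {f g : ℕ → ℚ} → (∀ k → f k ≡ g k) → sumℚ n f ≡ sumℚ n g
sumℚ-cong zero    f≗g = f≗g 0
sumℚ-cong (suc n) f≗g = cong₂ ℚ._+_ (sumℚ-cong n f≗g) (f≗g (suc n))

sumℚ-*ˡ : ∀ n (x : ℚ) (f : ℕ → ℚ) → sumℚ n (λ k → x ℚ.* f k) ≡ x ℚ.* sumℚ n f
sumℚ-*ˡ zero    x f = refl
sumℚ-*ˡ (suc n) x f =
  trans (cong (ℚ._+ (x ℚ.* f (suc n))) (sumℚ-*ˡ n x f)) (sym (ℚP.*-distribˡ-+ x (sumℚ n f) (f (suc n))))

mainTheorem17 : (n r : ℕ) →
    ℚ._/_ (+ Stirling2 (n ℕ.+ r) r) 1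
    ≡ ((+ ((n ℕ.+ r) !)) /fact r)
    ℚ.* sumℚ n (λ k → (rising (- (+ r)) k ℤ.* sumℤ k (λ l → signℤ l ℤ.* (+ ((n ℕ.+ k) C (k ∸ l)) ℤ.* + Stirling2 (n ℕ.+ l) l))) /fact (n ℕ.+ k))
mainTheorem17 n r = begin
  + Stirling2 (n ℕ.+ r) r ℚ./ 1     ≡⟨ cong (ℚ._/ 1) (Stirling2-binomial-expansion n r) ⟩
  sumℤ n coefficient ℚ./ 1          ≡⟨ sumℚ-/1 n coefficient ⟨
  sumℚ n (λ k → coefficient k ℚ./ 1) ≡⟨ sumℚ-cong n term ⟨
  sumℚ n (λ k → X ℚ.* summand k)    ≡⟨ sumℚ-*ˡ n X summand ⟩
  X ℚ.* sumℚ n summand              ∎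
  where
  coefficient : ℕ → ℤ
  coefficient k = signℤ k * + ((n ℕ.+ r) C (n ℕ.+ k)) * innerSum n k
  X = (+ ((n ℕ.+ r) !)) /fact r
  summand : ℕ → ℚ
  summand k = (rising (- + r) k * innerSum n k) /fact (n ℕ.+ k)
  term : ∀ k → X ℚ.* summand k ≡ coefficient k ℚ./ 1
  term k = /*/≡/1 (+ ((n ℕ.+ r) !)) (rising (- + r) k * innerSum n k) (coefficient k) (r !) ((n ℕ.+ k) !) {{r !≢0}} {{(n ℕ.+ k) !≢0}} (begin
    + ((n ℕ.+ r) !) * (rising (- + r) k * innerSum n k)    ≡⟨ ℤP.*-assoc (+ ((n ℕ.+ r) !)) (rising (- + r) k) (innerSum n k) ⟨
    + ((n ℕ.+ r) !) * rising (- + r) k * innerSum n k      ≡⟨ cong (_* innerSum n k) (!-*-rising-neg n r k) ⟩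
    signℤ k * c * + (r ! ℕ.* (n ℕ.+ k) !) * innerSum n k  ≡⟨ swap (signℤ k * c) (+ (r ! ℕ.* (n ℕ.+ k) !)) (innerSum n k) ⟩
    coefficient k * + (r ! ℕ.* (n ℕ.+ k) !)                ∎)
    where
    c = + ((n ℕ.+ r) C (n ℕ.+ k))
    swap : ∀ (a p x : ℤ) → a * p * x ≡ a * x * p
    swap = solve-∀
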